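{- For every integer $n \geq 3$ there exists a set of $n$-sided dice $(A,B,C)$ that is both balanced and non-transitive.
   Context: Fix an integer $n>0$ and write $[N]=\{1,\dots,N\}$. A set of $n$-sided dice is an ordered triple $(A,B,C)$ of pairwise disjoint sets with $|A|=|B|=|C|=n$ and $A\cup B\cup C=[3n]$; each die is fair, showing each of its $n$ labels with probability $1/n$, and dice are rolled independently. For dice $X,Y$, $P(X\succ Y)$ denotes the probability that the number rolled on $X$ exceeds the number rolled on $Y$, i.e. $P(X\succ Y)=\frac{1}{n^2}|\{(x,y)\in X\times Y: x>y\}|$. The set of dice is non-transitive if each of $P(A\succ B)$, $P(B\succ C)$, $P(C\succ A)$ exceeds $1/2$, and balanced if $P(A\succ B)=P(B\succ C)=P(C\succ A)$. -}

module Defs where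

open import Data.Nat using (ℕ; zero; suc; _+_; _*_; _<_; _<?_)
open import Data.Fin using (Fin; toℕ)
import Data.Fin as F
open import Data.Bool using (Bool; true; false; if_then_else_)
open import Relation.Nullary.Decidable using (does)
open import Data.Product using (_×_)
open import Relation.Binary.PropositionalEquality using (_≡_)

data Die : Set where
  A B C : Die

_≟D_ : Die → Die → Bool
A ≟D A = true
B ≟D B = true
C ≟D C = true
_ ≟D _ = false

count : ∀ {m} → (Fin m → Bool) → ℕ
count {zero}  p = 0
count {suc m} p = (if p F.zero then 1 else 0) + count (λ i → p (F.suc i))

-- A set of n-sided dice (A,B,C) is encoded as an assignment
-- d : Fin (3 * n) → Die, where the element i : Fin (3n) stands for the
-- label toℕ i + 1 ∈ [3n]; the die X is the set {toℕ i + 1 ∣ d i ≡ X}.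
-- Disjointness and covering of [3n] are automatic; we require |X| = n.
IsDiceSet : (n : ℕ) → (Fin (3 * n) → Die) → Set
IsDiceSet n d =
  (count (λ i → d i ≟D A) ≡ n) × (count (λ i → d i ≟D B) ≡ n) × (count (λ i → d i ≟D C) ≡ n)

sumFin : ∀ {m} → (Fin m → ℕ) → ℕ
sumFin {zero}  f = 0
sumFin {suc m} f = f F.zero + sumFin (λ i → f (F.suc i))

-- wins n d X Y = |{(x,y) ∈ X × Y : x > y}| (labels compared via toℕ,
-- which preserves order), so P(X ≻ Y) = wins n d X Y / n².
wins : (n : ℕ) → (Fin (3 * n) → Die) → Die → Die → ℕ
wins n d X Y =
  sumFin (λ x → if d x ≟D X
                  then count (λ y → if d y ≟D Y then does (toℕ y <? toℕ x) else false)
                  else 0)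

-- P(X ≻ Y) > 1/2  ⟺  2 · wins > n²
Beats : (n : ℕ) → (Fin (3 * n) → Die) → Die → Die → Set
Beats n d X Y = n * n < 2 * wins n d X Y

NonTransitive : (n : ℕ) → (Fin (3 * n) → Die) → Set
NonTransitive n d = Beats n d A B × Beats n d B C × Beats n d C A

-- equal probabilities ⟺ equal win counts (common denominator n²)
Balanced : (n : ℕ) → (Fin (3 * n) → Die) → Set
Balanced n d = (wins n d A B ≡ wins n d B C) × (wins n d B C ≡ wins n d C A)

-- Placing every label of one balanced non-transitive set (n₂ faces per die,
-- each die beating the next in w₂ pairs) above every label of another (n₁, w₁)
-- gives a balanced non-transitive set with n₁ + n₂ faces: each die gains the
-- n₂ n₁ pairs in which one of its high faces beats a low face of the next die,
-- so every score becomes w₁ + n₂ n₁ + w₂, and (n₁ + n₂)² < 2 (w₁ + n₂ n₁ + w₂)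
-- follows from nᵢ² < 2 wᵢ. Explicit sets with 3, 4 and 5 faces therefore
-- generate sets for every n ≥ 3.
module Submission where

open import Defs
open import Data.Nat using (ℕ; suc; _≤_; _*_; _+_; _<_; _<?_; s≤s)
open import Data.Nat.Properties
  using ( +-assoc; +-identityʳ; *-zeroʳ; *-identityˡ; *-distribˡ-+
        ; +-mono-<-≤; +-monoˡ-<; <⇒≤; module ≤-Reasoning)
open import Data.Nat.Tactic.RingSolver using (solve-∀)
open import Data.Fin using (Fin; toℕ)
import Data.Fin as F
open import Data.Vec using (Vec; lookup; []; _∷_; _++_)
open import Data.Bool using (Bool; true; false; if_then_else_)
open import Data.Product using (Σ; _×_; _,_)
open import Relation.Nullary.Decidable using (does; from-yes)
open import Relation.Binary.PropositionalEquality
  using (_≡_; refl; sym; trans; cong; cong₂; subst; module ≡-Reasoning)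

count-if-false : ∀ {m} (b : Fin m → Bool) → count (λ i → if b i then false else false) ≡ 0
count-if-false {0}     b = refl
count-if-false {suc m} b with b F.zero
... | true  = count-if-false (λ i → b (F.suc i))
... | false = count-if-false (λ i → b (F.suc i))

sumFin-if-+ : ∀ {m} (b : Fin m → Bool) (k : ℕ) (g : Fin m → ℕ) →
  sumFin (λ i → if b i then k + g i else 0) ≡ k * count b + sumFin (λ i → if b i then g i else 0)
sumFin-if-+ {0}     b k g = sym (trans (+-identityʳ _) (*-zeroʳ k))
sumFin-if-+ {suc m} b k g with b F.zero | sumFin-if-+ (λ i → b (F.suc i)) k (λ i → g (F.suc i))
... | true  | ih = trans (cong (k + g F.zero +_) ih) (regroup k (g F.zero) _ _)
  where
  regroup : ∀ k g c s → k + g + (k * c + s) ≡ k * (1 + c) + (g + s)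
  regroup = solve-∀
... | false | ih = ih

-- A vector v : Vec Die m lists the dice owning the labels 1, …, m in increasing
-- order; winsIn v is wins n (lookup v) with the length freed from 3 * n.

faces : ∀ {m} → Vec Die m → Die → ℕ
faces v X = count (λ i → lookup v i ≟D X)

winsIn : ∀ {m} → Vec Die m → Die → Die → ℕ
winsIn v X Y = sumFin (λ x → if lookup v x ≟D X
                                then count (λ y → if lookup v y ≟D Y then does (toℕ y <? toℕ x) else false)
                                else 0)

faces-++ : ∀ {m k} (u : Vec Die m) (v : Vec Die k) X → faces (u ++ v) X ≡ faces u X + faces v X
faces-++ []      v X = refl
faces-++ (Z ∷ u) v X =
  trans (cong ((if Z ≟D X then 1 else 0) +_) (faces-++ u v X)) (sym (+-assoc _ (faces u X) (faces v X)))

-- The lowest label is beaten by every other face of X, and beats nothing.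
winsIn-∷ : ∀ {m} Z (v : Vec Die m) X Y →
  winsIn (Z ∷ v) X Y ≡ (if Z ≟D Y then faces v X else 0) + winsIn v X Y
winsIn-∷ {m} Z v X Y = begin
  (if Z ≟D X then count (λ i → if lookup (Z ∷ v) i ≟D Y then false else false) else 0)
    + sumFin (λ x → if lookup v x ≟D X then lowestInY + below x else 0)
    ≡⟨ cong₂ _+_ lowest-beats-nothing (sumFin-if-+ (λ x → lookup v x ≟D X) lowestInY below) ⟩
  lowestInY * faces v X + winsIn v X Y
    ≡⟨ cong (_+ winsIn v X Y) (lowest-is-beaten (Z ≟D Y)) ⟩
  (if Z ≟D Y then faces v X else 0) + winsIn v X Y ∎
  where
  open ≡-Reasoning
  lowestInY : ℕ
  lowestInY = if (if Z ≟D Y then true else false) then 1 else 0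
  below : Fin m → ℕ
  below x = count (λ y → if lookup v y ≟D Y then does (toℕ y <? toℕ x) else false)
  lowest-beats-nothing : (if Z ≟D X then count (λ i → if lookup (Z ∷ v) i ≟D Y then false else false) else 0) ≡ 0
  lowest-beats-nothing with Z ≟D X
  ... | true  = count-if-false (λ i → lookup (Z ∷ v) i ≟D Y)
  ... | false = refl
  lowest-is-beaten : (b : Bool) → (if (if b then true else false) then 1 else 0) * faces v X
                                 ≡ (if b then faces v X else 0)
  lowest-is-beaten true  = *-identityˡ (faces v X)
  lowest-is-beaten false = refl

winsIn-++ : ∀ {m k} (u : Vec Die m) (v : Vec Die k) X Y →
  winsIn (u ++ v) X Y ≡ winsIn u X Y + faces v X * faces u Y + winsIn v X Y
winsIn-++ []      v X Y = cong (_+ winsIn v X Y) (sym (*-zeroʳ (faces v X)))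
winsIn-++ (Z ∷ u) v X Y = begin
  winsIn (Z ∷ u ++ v) X Y
    ≡⟨ winsIn-∷ Z (u ++ v) X Y ⟩
  (if Z ≟D Y then faces (u ++ v) X else 0) + winsIn (u ++ v) X Y
    ≡⟨ cong₂ (λ f w → (if Z ≟D Y then f else 0) + w) (faces-++ u v X) (winsIn-++ u v X Y) ⟩
  (if Z ≟D Y then faces u X + faces v X else 0) + (winsIn u X Y + faces v X * faces u Y + winsIn v X Y)
    ≡⟨ regroup (Z ≟D Y) ⟩
  (if Z ≟D Y then faces u X else 0) + winsIn u X Y + faces v X * ((if Z ≟D Y then 1 else 0) + faces u Y)
    + winsIn v X Y
    ≡⟨ cong (λ w → w + faces v X * faces (Z ∷ u) Y + winsIn v X Y) (sym (winsIn-∷ Z u X Y)) ⟩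
  winsIn (Z ∷ u) X Y + faces v X * faces (Z ∷ u) Y + winsIn v X Y ∎
  where
  open ≡-Reasoning
  regroup : (b : Bool) →
    (if b then faces u X + faces v X else 0) + (winsIn u X Y + faces v X * faces u Y + winsIn v X Y)
      ≡ (if b then faces u X else 0) + winsIn u X Y + faces v X * ((if b then 1 else 0) + faces u Y)
        + winsIn v X Y
  regroup true  = true-case (faces u X) (faces v X) (winsIn u X Y) (faces u Y) (winsIn v X Y)
    where
    true-case : ∀ a b w c w′ → a + b + (w + b * c + w′) ≡ a + w + b * (1 + c) + w′
    true-case = solve-∀
  regroup false = refl

sum-square-< : ∀ n₁ n₂ w₁ w₂ → n₁ * n₁ < 2 * w₁ → n₂ * n₂ < 2 * w₂ →
  (n₁ + n₂) * (n₁ + n₂) < 2 * (w₁ + n₂ * n₁ + w₂)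
sum-square-< n₁ n₂ w₁ w₂ h₁ h₂ = begin-strict
  (n₁ + n₂) * (n₁ + n₂)             ≡⟨ square-+ n₁ n₂ ⟩
  n₁ * n₁ + 2 * (n₂ * n₁) + n₂ * n₂ <⟨ +-mono-<-≤ (+-monoˡ-< (2 * (n₂ * n₁)) h₁) (<⇒≤ h₂) ⟩
  2 * w₁ + 2 * (n₂ * n₁) + 2 * w₂   ≡⟨ double-+ w₁ (n₂ * n₁) w₂ ⟩
  2 * (w₁ + n₂ * n₁ + w₂)           ∎
  where
  open ≤-Reasoning
  square-+ : ∀ a b → (a + b) * (a + b) ≡ a * a + 2 * (b * a) + b * b
  square-+ = solve-∀
  double-+ : ∀ a b c → 2 * a + 2 * b + 2 * c ≡ 2 * (a + b + c)
  double-+ = solve-∀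

next : Die → Die
next A = B
next B = C
next C = A

record BalancedNonTransitive (m n : ℕ) : Set where
  field
    dice          : Vec Die m
    score         : ℕ
    size          : ∀ X → faces dice X ≡ n
    balanced      : ∀ X → winsIn dice X (next X) ≡ score
    nontransitive : n * n < 2 * score

open BalancedNonTransitive

_⊕_ : ∀ {m₁ n₁ m₂ n₂} → BalancedNonTransitive m₁ n₁ → BalancedNonTransitive m₂ n₂ →
      BalancedNonTransitive (m₁ + m₂) (n₁ + n₂)
_⊕_ {n₁ = n₁} {n₂ = n₂} s₁ s₂ = record
  { dice          = dice s₁ ++ dice s₂
  ; score         = score s₁ + n₂ * n₁ + score s₂
  ; size          = λ X → trans (faces-++ (dice s₁) (dice s₂) X) (cong₂ _+_ (size s₁ X) (size s₂ X))
  ; balanced      = λ X → begin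
      winsIn (dice s₁ ++ dice s₂) X (next X)
        ≡⟨ winsIn-++ (dice s₁) (dice s₂) X (next X) ⟩
      winsIn (dice s₁) X (next X) + faces (dice s₂) X * faces (dice s₁) (next X) + winsIn (dice s₂) X (next X)
        ≡⟨ cong₂ _+_ (cong₂ _+_ (balanced s₁ X) (cong₂ _*_ (size s₂ X) (size s₁ (next X)))) (balanced s₂ X) ⟩
      score s₁ + n₂ * n₁ + score s₂ ∎
  ; nontransitive = sum-square-< n₁ n₂ (score s₁) (score s₂) (nontransitive s₁) (nontransitive s₂)
  }
  where open ≡-Reasoning

three : BalancedNonTransitive 9 3
three = record
  { dice          = A ∷ C ∷ B ∷ B ∷ A ∷ C ∷ C ∷ B ∷ A ∷ []
  ; score         = 5
  ; size          = λ { A → refl ; B → refl ; C → refl }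
  ; balanced      = λ { A → refl ; B → refl ; C → refl }
  ; nontransitive = from-yes (3 * 3 <? 2 * 5)
  }

four : BalancedNonTransitive 12 4
four = record
  { dice          = A ∷ B ∷ A ∷ C ∷ C ∷ C ∷ B ∷ B ∷ B ∷ A ∷ C ∷ A ∷ []
  ; score         = 9
  ; size          = λ { A → refl ; B → refl ; C → refl }
  ; balanced      = λ { A → refl ; B → refl ; C → refl }
  ; nontransitive = from-yes (4 * 4 <? 2 * 9)
  }

five : BalancedNonTransitive 15 5
five = record
  { dice          = A ∷ A ∷ B ∷ C ∷ B ∷ C ∷ B ∷ A ∷ C ∷ C ∷ C ∷ B ∷ B ∷ A ∷ A ∷ []
  ; score         = 13
  ; size          = λ { A → refl ; B → refl ; C → refl }
  ; balanced      = λ { A → refl ; B → refl ; C → refl }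
  ; nontransitive = from-yes (5 * 5 <? 2 * 13)
  }

balancedNonTransitive : ∀ k → BalancedNonTransitive (3 * (3 + k)) (3 + k)
balancedNonTransitive 0 = three
balancedNonTransitive 1 = four
balancedNonTransitive 2 = five
balancedNonTransitive (suc (suc (suc k))) =
  subst (λ m → BalancedNonTransitive m (6 + k)) (sym (*-distribˡ-+ 3 3 (3 + k)))
        (three ⊕ balancedNonTransitive k)

diceSet : ∀ {n} → BalancedNonTransitive (3 * n) n →
  Σ (Fin (3 * n) → Die) (λ d → IsDiceSet n d × Balanced n d × NonTransitive n d)
diceSet {n} s =
  lookup (dice s) ,
  (size s A , size s B , size s C) ,
  (trans (balanced s A) (sym (balanced s B)) , trans (balanced s B) (sym (balanced s C))) ,
  (beats A , beats B , beats C)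
  where
  beats : ∀ X → n * n < 2 * winsIn (dice s) X (next X)
  beats X = subst (λ w → n * n < 2 * w) (sym (balanced s X)) (nontransitive s)

theorem2p1 : (n : ℕ) → 3 ≤ n →
    Σ (Fin (3 * n) → Die) (λ d → IsDiceSet n d × Balanced n d × NonTransitive n d)
theorem2p1 _ (s≤s (s≤s (s≤s _))) = diceSet (balancedNonTransitive _)
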